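{- Let $2\le n_1<\cdots<n_m$, $t_1,\dots,t_m\ge1$, $\overline{t}_k=\sum_{i=1}^k t_i$, $t=\overline{t}_m$, $N=\prod n_i^{t_i}$, $G=K_{n_1}^{t_1}\square\cdots\square K_{n_m}^{t_m}$, and let $O=(v^1,\dots,v^N)$ be an ordering of $V(G)$ that induces a consecutive radio labeling of $G$. Then for every $1\le k\le m$ and every $i\ge1$ with $i+n_k\le N$, $$\alpha_{n_k}^i\le t-\overline{t}_k.$$
   Context: $K_n$ is the complete graph on $\{v_1,\dots,v_n\}$; $\square$ is the Cartesian product and $H^s$ the $s$-fold Cartesian power. Vertices of $G$ are $t$-tuples $(x_1,\dots,x_t)$ with $x_j\in V(K_{n_k})$ for $\overline{t}_{k-1}<j\le\overline{t}_k$ ($\overline{t}_0=0$); distance is the number of differing coordinates, $\mathrm{diam}(G)=t$. Write $v^i=(v^i_1,\dots,v^i_t)$. An ordering is a list of all vertices without repetition; a radio labeling of $H$ is $f:V(H)\to\mathbb{Z}^+$ with $|f(u)-f(v)|\ge\mathrm{diam}(H)+1-d(u,v)$ for distinct $u,v$, consecutive if bijective onto $\{1,\dots,|V(H)|\}$; the labeling induced by an ordering is $f(v^1)=1$, $f(v^i)=\min\{x\in\mathbb{Z}:x>f(v^{i-1}),\ |x-f(v^j)|\ge\mathrm{diam}+1-d(v^i,v^j)\ \forall j<i\}$. For $i\ge1$, $k\ge0$ with $i+k\le N$, $\alpha_k^i$ is the number of column indices $j$ such that $v^i_j,\dots,v^{i+k}_j$ are pairwise distinct. -}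

module Defs where

open import Data.Nat using (ℕ; zero; suc; _+_; _*_; _∸_; _^_; _≤_; _<_; z≤n; s≤s; ∣_-_∣)
open import Data.Nat.Properties using (≤-trans; +-monoʳ-≤)
open import Data.Fin using (Fin; toℕ) renaming (zero to fz; suc to fs)
open import Data.Fin.Properties using (_≟_)
open import Data.Bool using (Bool; true; false; _∧_; if_then_else_)
open import Data.List using (List; []; _∷_)
open import Data.Product using (Σ; _×_; _,_)
open import Relation.Nullary using (does)
import Relation.Binary.PropositionalEquality
open Relation.Binary.PropositionalEquality using (_≡_)

ΣFin : (n : ℕ) → (Fin n → ℕ) → ℕ
ΣFin zero    f = 0
ΣFin (suc n) f = f fz + ΣFin n (λ i → f (fs i))

ΠFin : (n : ℕ) → (Fin n → ℕ) → ℕ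
ΠFin zero    f = 1
ΠFin (suc n) f = f fz * ΠFin n (λ i → f (fs i))

countFin : (n : ℕ) → (Fin n → Bool) → ℕ
countFin n p = ΣFin n (λ i → if p i then 1 else 0)

-- Parameters of G = K_{n_1}^{t_1} □ ... □ K_{n_m}^{t_m} (blocks indexed 0..m-1):
--   ns k = n_{k+1},  ts k = t_{k+1}.
-- A vertex is a tuple whose columns are grouped in blocks: block k has ts k columns,
-- each taking a value in V(K_{ns k}) ≅ Fin (ns k).
Vertex : (m : ℕ) → (ns ts : Fin m → ℕ) → Set
Vertex m ns ts = (k : Fin m) → Fin (ts k) → Fin (ns k)

-- t = total number of columns = diam(G)
tot : (m : ℕ) → (Fin m → ℕ) → ℕ
tot m ts = ΣFin m ts

tbar : (m : ℕ) → (Fin m → ℕ) → Fin m → ℕ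
tbar m ts k = ΣFin m (λ k' → if does (toℕ k' Data.Nat.≤? toℕ k) then ts k' else 0)

order : (m : ℕ) → (ns ts : Fin m → ℕ) → ℕ
order m ns ts = ΠFin m (λ k → ns k ^ ts k)

dist : (m : ℕ) (ns ts : Fin m → ℕ) → Vertex m ns ts → Vertex m ns ts → ℕ
dist m ns ts u v =
  ΣFin m (λ k → countFin (ts k) (λ l → Data.Bool.not (does (u k l ≟ v k l))))

IsOrdering : (m : ℕ) (ns ts : Fin m → ℕ) → (Fin (order m ns ts) → Vertex m ns ts) → Set
IsOrdering m ns ts O =
  ((i j : Fin (order m ns ts)) → (∀ k l → O i k l ≡ O j k l) → i ≡ j)
  × ((v : Vertex m ns ts) → Σ (Fin (order m ns ts)) λ i → ∀ k l → O i k l ≡ v k l)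

RadioOK : (m : ℕ) (ns ts : Fin m → ℕ) (O : Fin (order m ns ts) → Vertex m ns ts)
          (f : Fin (order m ns ts) → ℕ) → Fin (order m ns ts) → ℕ → Set
RadioOK m ns ts O f i x =
  (j : Fin (order m ns ts)) → toℕ j Data.Nat.< toℕ i →
  suc (tot m ts) ∸ dist m ns ts (O i) (O j) ≤ ∣ x - f j ∣

-- f is the labeling induced by the ordering O (f i is the label of v^{i+1}):
-- f(v^1) = 1 and f(v^i) is the least integer x > f(v^{i-1}) satisfying the radio constraints.
IsInducedLabeling : (m : ℕ) (ns ts : Fin m → ℕ) (O : Fin (order m ns ts) → Vertex m ns ts)
                    (f : Fin (order m ns ts) → ℕ) → Set
IsInducedLabeling m ns ts O f =
  ((i : Fin (order m ns ts)) → toℕ i ≡ 0 → f i ≡ 1)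
  × ((i i' : Fin (order m ns ts)) → toℕ i' ≡ suc (toℕ i) →
       (f i Data.Nat.< f i')
       × RadioOK m ns ts O f i' (f i')
       × ((x : ℕ) → f i Data.Nat.< x → RadioOK m ns ts O f i' x → f i' ≤ x))

-- the labeling (as a labeling of positions of O, i.e. of vertices since O is a bijection)
-- is consecutive: a bijection onto {1,...,N}
IsConsecutive : (N : ℕ) → (Fin N → ℕ) → Set
IsConsecutive N f =
  ((i : Fin N) → 1 ≤ f i × f i ≤ N)
  × ((i j : Fin N) → f i ≡ f j → i ≡ j)
  × ((x : ℕ) → 1 ≤ x → x ≤ N → Σ (Fin N) λ i → f i ≡ x)

InducesConsecutive : (m : ℕ) (ns ts : Fin m → ℕ) → (Fin (order m ns ts) → Vertex m ns ts) → Set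
InducesConsecutive m ns ts O =
  Σ (Fin (order m ns ts) → ℕ) λ f → IsInducedLabeling m ns ts O f × IsConsecutive (order m ns ts) f

pairwiseDistinct : {n : ℕ} → List (Fin n) → Bool
pairwiseDistinct [] = true
pairwiseDistinct (x ∷ xs) = notIn x xs ∧ pairwiseDistinct xs
  where
  notIn : {n : ℕ} → Fin n → List (Fin n) → Bool
  notIn x [] = true
  notIn x (y ∷ ys) = Data.Bool.not (does (x ≟ y)) ∧ notIn x ys

-- the vertices at 0-indexed positions i, i+1, ..., i+a (given i + a < N), read off in
-- column (k,l): list [v_{i+a}, ..., v_i] at that column
column : (m : ℕ) (ns ts : Fin m → ℕ) (O : Fin (order m ns ts) → Vertex m ns ts)
         (k : Fin m) (l : Fin (ts k)) (i a : ℕ) → i + a Data.Nat.< order m ns ts → List (Fin (ns k))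
column m ns ts O k l i zero p = O (Data.Fin.fromℕ< (≤-trans (s≤s (Data.Nat.Properties.≤-reflexive (Relation.Binary.PropositionalEquality.sym (Data.Nat.Properties.+-identityʳ i)))) p)) k l ∷ []
column m ns ts O k l i (suc a) p =
  O (Data.Fin.fromℕ< p) k l
  ∷ column m ns ts O k l i a (≤-trans (s≤s (+-monoʳ-≤ i (Data.Nat.Properties.n≤1+n a))) p)

-- α^i_a (positions 0-indexed: paper's α^{i+1}_a): number of columns c such that
-- v^{i+1}_c, ..., v^{i+1+a}_c are pairwise distinct
alpha : (m : ℕ) (ns ts : Fin m → ℕ) (O : Fin (order m ns ts) → Vertex m ns ts)
        (i a : ℕ) → i + a Data.Nat.< order m ns ts → ℕ
alpha m ns ts O i a p =
  ΣFin m (λ k → countFin (ts k) (λ l → pairwiseDistinct (column m ns ts O k l i a p)))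

-- A column of block k' ≤ k takes at most n_{k'} ≤ n_k values, so by pigeonhole two of the
-- n_k + 1 vertices v^i, …, v^{i+n_k} agree in it. Hence only the t − t̄_k columns of the
-- blocks after k can contribute to α^i_{n_k}.
module Submission where

open import Defs
open import Data.Nat using (ℕ; zero; suc; _+_; _∸_; _≤_; _<_; z≤n; s≤s; _≤?_; _≤ᵇ_)
open import Data.Nat.Properties
  using (≤-refl; n<1+n; ≤-reflexive; ≤-trans; <⇒≤; ≮⇒≥; <-irrefl; m≤n⇒m≤1+n; +-mono-≤; +-identityʳ;
         m+n≤o⇒m≤o∸n; ≤ᵇ-reflects-≤; module ≤-Reasoning; +-commutativeSemigroup)
open import Data.Fin using (Fin; toℕ) renaming (zero to fz; suc to fs)
import Data.Fin.Properties as Fin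
open import Data.Bool using (Bool; true; false; _∧_; not; if_then_else_)
open import Data.List using (List; []; _∷_; length; lookup)
open import Data.Product using (_×_; _,_; proj₁; proj₂)
open import Data.Empty using (⊥-elim)
open import Function using (_∘_)
open import Relation.Nullary using (¬_; Dec; does; yes; no; ofʸ)
open import Relation.Binary.PropositionalEquality using (_≡_; _≢_; refl; cong; module ≡-Reasoning)
open import Algebra.Properties.CommutativeSemigroup +-commutativeSemigroup using (interchange)

ΣFin-mono : ∀ n {f g : Fin n → ℕ} → (∀ i → f i ≤ g i) → ΣFin n f ≤ ΣFin n g
ΣFin-mono zero    f≤g = z≤n
ΣFin-mono (suc n) f≤g = +-mono-≤ (f≤g fz) (ΣFin-mono n (f≤g ∘ fs))

ΣFin-+ : ∀ n (f g : Fin n → ℕ) → ΣFin n f + ΣFin n g ≡ ΣFin n (λ i → f i + g i)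
ΣFin-+ zero    f g = refl
ΣFin-+ (suc n) f g = begin
  f fz + ΣFin n (f ∘ fs) + (g fz + ΣFin n (g ∘ fs))  ≡⟨ interchange (f fz) _ (g fz) _ ⟩
  f fz + g fz + (ΣFin n (f ∘ fs) + ΣFin n (g ∘ fs))  ≡⟨ cong (f fz + g fz +_) (ΣFin-+ n (f ∘ fs) (g ∘ fs)) ⟩
  f fz + g fz + ΣFin n (λ i → f (fs i) + g (fs i))  ∎
  where open ≡-Reasoning

countFin≤ : ∀ n (p : Fin n → Bool) → countFin n p ≤ n
countFin≤ zero    p = z≤n
countFin≤ (suc n) p with p fz
... | true  = s≤s (countFin≤ n (p ∘ fs))
... | false = m≤n⇒m≤1+n (countFin≤ n (p ∘ fs))

countFin-none : ∀ n (p : Fin n → Bool) → (∀ i → p i ≢ true) → countFin n p ≡ 0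
countFin-none zero    p none = refl
countFin-none (suc n) p none with p fz | none fz
... | true  | ≢true = ⊥-elim (≢true refl)
... | false | _     = countFin-none n (p ∘ fs) (none ∘ fs)

strictMono⇒mono : ∀ {m} (f : Fin m → ℕ) → (∀ k k' → toℕ k < toℕ k' → f k < f k') →
                  ∀ k k' → toℕ k ≤ toℕ k' → f k ≤ f k'
strictMono⇒mono f f-strict k k' k≤k' with k Fin.≟ k'
... | yes refl = ≤-refl
... | no  k≢k' = <⇒≤ (f-strict k k' (Fin.≤∧≢⇒< k≤k' k≢k'))

∧-true⁻ : ∀ {a b} → a ∧ b ≡ true → a ≡ true × b ≡ true
∧-true⁻ {true} b≡true = refl , b≡true

∧-true⁺ : ∀ {a b} → a ≡ true → b ≡ true → a ∧ b ≡ true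
∧-true⁺ refl refl = refl

not-does⇒¬ : ∀ {a} {A : Set a} (a? : Dec A) → not (does a?) ≡ true → ¬ A
not-does⇒¬ (no ¬a) _ = ¬a

module _ {n : ℕ} where

  pairwiseDistinct-tail : ∀ (x : Fin n) xs → pairwiseDistinct (x ∷ xs) ≡ true → pairwiseDistinct xs ≡ true
  pairwiseDistinct-tail x xs = proj₂ ∘ ∧-true⁻

  pairwiseDistinct-uncons : ∀ (x y : Fin n) ys → pairwiseDistinct (x ∷ y ∷ ys) ≡ true →
                            x ≢ y × pairwiseDistinct (x ∷ ys) ≡ true
  pairwiseDistinct-uncons x y ys distinct =
    let x∉y∷ys , y∷ys-distinct = ∧-true⁻ distinct
        x≢y , x∉ys = ∧-true⁻ x∉y∷ys
    in not-does⇒¬ (x Fin.≟ y) x≢y , ∧-true⁺ x∉ys (proj₂ (∧-true⁻ y∷ys-distinct))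

  pairwiseDistinct-head∉ : ∀ (x : Fin n) xs → pairwiseDistinct (x ∷ xs) ≡ true →
                           (j : Fin (length xs)) → x ≢ lookup xs j
  pairwiseDistinct-head∉ x (y ∷ ys) distinct fz     = proj₁ (pairwiseDistinct-uncons x y ys distinct)
  pairwiseDistinct-head∉ x (y ∷ ys) distinct (fs j) =
    pairwiseDistinct-head∉ x ys (proj₂ (pairwiseDistinct-uncons x y ys distinct)) j

  pairwiseDistinct⇒lookup-≢ : ∀ (xs : List (Fin n)) → pairwiseDistinct xs ≡ true →
                              ∀ i j → toℕ i < toℕ j → lookup xs i ≢ lookup xs j
  pairwiseDistinct⇒lookup-≢ (x ∷ xs) distinct fz     (fs j) _         =
    pairwiseDistinct-head∉ x xs distinct j
  pairwiseDistinct⇒lookup-≢ (x ∷ xs) distinct (fs i) (fs j) (s≤s i<j) =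
    pairwiseDistinct⇒lookup-≢ xs (pairwiseDistinct-tail x xs distinct) i j i<j

  pairwiseDistinct⇒length≤ : ∀ (xs : List (Fin n)) → pairwiseDistinct xs ≡ true → length xs ≤ n
  pairwiseDistinct⇒length≤ xs distinct = ≮⇒≥ λ n<length →
    let i , j , i<j , same = Fin.pigeonhole n<length (lookup xs)
    in pairwiseDistinct⇒lookup-≢ xs distinct i j i<j same

module _ (m : ℕ) (ns ts : Fin m → ℕ) (O : Fin (order m ns ts) → Vertex m ns ts) where

  length-column : ∀ k l i a (p : i + a < order m ns ts) → length (column m ns ts O k l i a p) ≡ suc a
  length-column k l i zero    p = refl
  length-column k l i (suc a) p = cong suc (length-column k l i a _)

  column-not-distinct : ∀ k l i a (p : i + a < order m ns ts) → ns k ≤ a →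
                        ¬ pairwiseDistinct (column m ns ts O k l i a p) ≡ true
  column-not-distinct k l i a p nsk≤a distinct = <-irrefl refl (begin-strict
    ns k                                   ≤⟨ nsk≤a ⟩
    a                                      <⟨ n<1+n a ⟩
    suc a                                  ≡⟨ length-column k l i a p ⟨
    length (column m ns ts O k l i a p)    ≤⟨ pairwiseDistinct⇒length≤ (column m ns ts O k l i a p) distinct ⟩
    ns k                                   ∎)
    where open ≤-Reasoning

proposition15 : (m : ℕ) (ns ts : Fin m → ℕ) →
    ((k : Fin m) → 2 ≤ ns k) →
    ((k k' : Fin m) → toℕ k < toℕ k' → ns k < ns k') →
    ((k : Fin m) → 1 ≤ ts k) →
    (O : Fin (order m ns ts) → Vertex m ns ts) →
    IsOrdering m ns ts O →
    InducesConsecutive m ns ts O →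
    (k : Fin m) (i : ℕ) (p : i + ns k < order m ns ts) →
    alpha m ns ts O i (ns k) p ≤ tot m ts ∸ tbar m ts k
proposition15 m ns ts _ ns-strict _ O _ _ k i p = m+n≤o⇒m≤o∸n _ (begin
  alpha m ns ts O i (ns k) p + tbar m ts k         ≡⟨ ΣFin-+ m _ _ ⟩
  ΣFin m (λ k' → distinctColumns k' + earlier k')  ≤⟨ ΣFin-mono m perBlock ⟩
  tot m ts                                         ∎)
  where
  open ≤-Reasoning

  distinctColumns : Fin m → ℕ
  distinctColumns k' = countFin (ts k') (λ l → pairwiseDistinct (column m ns ts O k' l i (ns k) p))

  earlier : Fin m → ℕ
  earlier k' = if does (toℕ k' ≤? toℕ k) then ts k' else 0

  perBlock : ∀ k' → distinctColumns k' + earlier k' ≤ ts k'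
  -- does (_ ≤? _) computes to _≤ᵇ_, so matching on the Dec itself would not refine earlier k'.
  perBlock k' with toℕ k' ≤ᵇ toℕ k | ≤ᵇ-reflects-≤ (toℕ k') (toℕ k)
  ... | true  | ofʸ k'≤k = ≤-reflexive (cong (_+ ts k') (countFin-none (ts k') _ λ l →
                  column-not-distinct m ns ts O k' l i (ns k) p (strictMono⇒mono ns ns-strict k' k k'≤k)))
  ... | false | _        = ≤-trans (≤-reflexive (+-identityʳ _)) (countFin≤ (ts k') _)
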